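{- Let $G$ be a connected graph with $D(G)=2$ that has no pair of distinct true twins, and suppose $G^c$ is connected. Then: (1) $\operatorname{Sd}_s(G,G^c)=\dim_s(G)$ if and only if there exists a vertex cover of $G^c$ of cardinality $\beta(G^c)$ which is a strong metric generator for $G^c$; (2) $\operatorname{Sd}_s(G,G^c)=\dim_s(G)=\dim_s(G^c)$ if and only if there exists a vertex cover of $G^c$ of cardinality $\beta(G^c)$ which is a strong metric generator of $G^c$ of cardinality $\dim_s(G^c)$.
   Context: All graphs are finite, simple and undirected; $G^c$ denotes the complement of $G$ on the same vertex set and $D(H)$ the diameter of a connected graph $H$. Two distinct vertices $x,y$ are true twins in $G$ if $N_G[x]=N_G[y]$ (closed neighbourhoods). For a connected graph $H$, $d_H(x,y)$ is the length of a shortest $x$–$y$ path; a vertex $w$ strongly resolves $u,v$ if $d_H(u,w)=d_H(u,v)+d_H(v,w)$ or $d_H(v,w)=d_H(v,u)+d_H(u,w)$; a set $S\subseteq V(H)$ is a strong metric generator for $H$ if every two distinct vertices are strongly resolved by some vertex of $S$, and $\dim_s(H)$ is the minimum cardinality of such a set. For connected graphs $G_1,\dots,G_k$ on a common vertex set $V$, $\operatorname{Sd}_s(G_1,\dots,G_k)$ is the minimum cardinality of a set $S\subseteq V$ that is a strong metric generator for every $G_i$. A vertex cover of $H$ is a set of vertices meeting every edge, and $\beta(H)$ is the minimum cardinality of a vertex cover of $H$. -}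

module Defs where

open import Data.Nat using (ℕ; zero; suc; _+_; _≤_; _<_)
open import Data.Fin using (Fin; _≟_)
open import Data.Fin.Subset using (Subset; _∈_; ∣_∣)
open import Data.Bool using (Bool; true; false; not; _∧_)
open import Data.Product using (Σ; ∃; ∃-syntax; _×_; _,_)
open import Data.Sum using (_⊎_)
open import Relation.Nullary using (¬_; Dec; yes; no)
open import Relation.Nullary.Decidable using (⌊_⌋)
open import Relation.Binary.PropositionalEquality using (_≡_; _≢_)
open import Function.Bundles using (_⇔_)

record Graph (n : ℕ) : Set where
  field
    adj   : Fin n → Fin n → Bool
    adj-sym : ∀ x y → adj x y ≡ adj y x
    adj-irrefl : ∀ x → adj x x ≡ false
open Graph public

Adj : ∀ {n} → Graph n → Fin n → Fin n → Set
Adj G x y = adj G x y ≡ true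

complement : ∀ {n} → Graph n → Graph n
complement {n} G = record
  { adj = λ x y → not (adj G x y) ∧ not ⌊ x ≟ y ⌋
  ; adj-sym = symc
  ; adj-irrefl = irc
  }
  where
  open import Relation.Binary.PropositionalEquality using (refl; sym)
  symc : ∀ x y → (not (adj G x y) ∧ not ⌊ x ≟ y ⌋) ≡ (not (adj G y x) ∧ not ⌊ y ≟ x ⌋)
  symc x y with x ≟ y | y ≟ x
  ... | yes _ | yes _ = symAnd
    where symAnd : (not (adj G x y) ∧ false) ≡ (not (adj G y x) ∧ false)
          symAnd rewrite adj-sym G x y = refl
  ... | yes p | no q = Data.Empty.⊥-elim (q (sym p))
    where import Data.Empty
  ... | no q | yes p = Data.Empty.⊥-elim (q (sym p))
    where import Data.Empty
  ... | no _ | no _ rewrite adj-sym G x y = refl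
  irc : ∀ x → (not (adj G x x) ∧ not ⌊ x ≟ x ⌋) ≡ false
  irc x with x ≟ x
  ... | yes _ rewrite adj-irrefl G x = refl
  ... | no ¬p = Data.Empty.⊥-elim (¬p refl)
    where import Data.Empty

data Walk {n} (G : Graph n) : Fin n → Fin n → ℕ → Set where
  here : ∀ {x} → Walk G x x zero
  step : ∀ {x y z k} → Adj G x y → Walk G y z k → Walk G x z (suc k)

Connected : ∀ {n} → Graph n → Set
Connected G = ∀ x y → ∃[ k ] Walk G x y k

IsDist : ∀ {n} → Graph n → Fin n → Fin n → ℕ → Set
IsDist G x y d = Walk G x y d × (∀ k → k < d → ¬ Walk G x y k)

IsDiameter : ∀ {n} → Graph n → ℕ → Set
IsDiameter G D =
  (∀ x y d → IsDist G x y d → d ≤ D) × (∃[ x ] ∃[ y ] IsDist G x y D)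

TrueTwins : ∀ {n} → Graph n → Fin n → Fin n → Set
TrueTwins G x y = ∀ z → ((z ≡ x ⊎ Adj G x z) ⇔ (z ≡ y ⊎ Adj G y z))

NoTrueTwins : ∀ {n} → Graph n → Set
NoTrueTwins G = ∀ x y → x ≢ y → ¬ TrueTwins G x y

StronglyResolves : ∀ {n} → Graph n → Fin n → Fin n → Fin n → Set
StronglyResolves H w u v =
  ∃[ duw ] ∃[ duv ] ∃[ dvw ]
    IsDist H u w duw × IsDist H u v duv × IsDist H v w dvw ×
    (duw ≡ duv + dvw ⊎ dvw ≡ duv + duw)

IsStrongMetricGenerator : ∀ {n} → Graph n → Subset n → Set
IsStrongMetricGenerator H S =
  ∀ u v → u ≢ v → ∃[ w ] (w ∈ S × StronglyResolves H w u v)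

IsStrongMetricDim : ∀ {n} → Graph n → ℕ → Set
IsStrongMetricDim H k =
  (∃[ S ] (IsStrongMetricGenerator H S × ∣ S ∣ ≡ k)) ×
  (∀ S → IsStrongMetricGenerator H S → k ≤ ∣ S ∣)

IsSimStrongMetricDim : ∀ {n} → Graph n → Graph n → ℕ → Set
IsSimStrongMetricDim G₁ G₂ k =
  (∃[ S ] (IsStrongMetricGenerator G₁ S × IsStrongMetricGenerator G₂ S × ∣ S ∣ ≡ k)) ×
  (∀ S → IsStrongMetricGenerator G₁ S → IsStrongMetricGenerator G₂ S → k ≤ ∣ S ∣)

IsVertexCover : ∀ {n} → Graph n → Subset n → Set
IsVertexCover H C = ∀ x y → Adj H x y → (x ∈ C ⊎ y ∈ C)

IsVertexCoverNumber : ∀ {n} → Graph n → ℕ → Set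
IsVertexCoverNumber H k =
  (∃[ C ] (IsVertexCover H C × ∣ C ∣ ≡ k)) ×
  (∀ C → IsVertexCover H C → k ≤ ∣ C ∣)

-- In a graph of diameter 2, two distinct non-adjacent vertices u, v are at
-- distance 2, so a vertex strongly resolving them must be u or v itself:
-- every strong metric generator of G is a vertex cover of Gᶜ.  Conversely,
-- in a connected graph without true twins every vertex cover S of Gᶜ strongly
-- resolves G: a non-edge of G has an endpoint in S, and an edge uv has a
-- vertex z ∈ N[u] ∖ N[v], so zv is an edge of Gᶜ and either v ∈ S or z ∈ S,
-- the latter resolving u, v because d(z, v) = 2 = d(z, u) + d(u, v).
-- Hence the strong metric generators of G are exactly the vertex covers of
-- Gᶜ, so dim_s(G) = β(Gᶜ), and both equivalences reduce to comparing minima.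
module Submission where

open import Defs
open import Data.Nat using (ℕ; zero; suc; _+_; _≤_; _<_; z≤n; s≤s)
open import Data.Nat.Properties
  using (≤-refl; ≤-trans; ≤-reflexive; ≤-antisym; +-identityʳ; +-cancelˡ-≤; n≤0⇒n≡0; m<1+n⇒m<n∨m≡n)
open import Data.Fin using (Fin; _≟_)
open import Data.Fin.Subset using (_∈_; ∣_∣)
open import Data.Fin.Properties using (any?; all?; ¬∀⟶∃¬)
open import Data.Bool using (true; false)
import Data.Bool as Bool
open import Data.Product using (∃-syntax; _×_; _,_; proj₂)
open import Data.Sum using (_⊎_; inj₁; inj₂; [_,_])
open import Relation.Nullary using (¬_; Dec; yes; no; contradiction)
open import Relation.Nullary.Decidable using (_×-dec_; _⊎-dec_; _→-dec_)
open import Relation.Binary.PropositionalEquality using (_≡_; _≢_; refl; sym; trans; subst)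
open import Function using (_∘_)
open import Function.Bundles using (_⇔_; mk⇔; Equivalence)

least-witness : {P : ℕ → Set} → (∀ k → Dec (P k)) →
                ∀ {k} → P k → ∃[ d ] (P d × (∀ j → j < d → ¬ P j))
least-witness {P} P? {k} pk with none-below-or-least (suc k)
  where
  none-below-or-least : ∀ m → (∀ j → j < m → ¬ P j) ⊎ ∃[ d ] (P d × (∀ j → j < d → ¬ P j))
  none-below-or-least zero = inj₁ (λ _ ())
  none-below-or-least (suc m) with none-below-or-least m
  ... | inj₂ least = inj₂ least
  ... | inj₁ none with P? m
  ...   | yes pm = inj₂ (m , pm , none)
  ...   | no ¬pm = inj₁ λ j j<1+m → [ none j , (λ { refl → ¬pm }) ] (m<1+n⇒m<n∨m≡n j<1+m)
... | inj₁ none = contradiction pk (none k ≤-refl)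
... | inj₂ least = least

m+n≤2≤m⇒n≡0 : ∀ {m n} → 2 ≤ m → m + n ≤ 2 → n ≡ 0
m+n≤2≤m⇒n≡0 {m} {n} 2≤m m+n≤2 =
  n≤0⇒n≡0 (+-cancelˡ-≤ m n 0 (≤-trans m+n≤2 (≤-trans 2≤m (≤-reflexive (sym (+-identityʳ m))))))

¬[A→B]⇒A×¬B : {A B : Set} → Dec A → ¬ (A → B) → A × ¬ B
¬[A→B]⇒A×¬B (yes a) ¬a→b = a , λ b → ¬a→b (λ _ → b)
¬[A→B]⇒A×¬B (no ¬a) ¬a→b = contradiction (λ a → contradiction a ¬a) ¬a→b

ClosedNbhd : ∀ {n} → Graph n → Fin n → Fin n → Set
ClosedNbhd G x z = z ≡ x ⊎ Adj G x z

module _ {n} (G : Graph n) where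

  Adj? : ∀ x y → Dec (Adj G x y)
  Adj? x y = adj G x y Bool.≟ true

  Adj-sym : ∀ {x y} → Adj G x y → Adj G y x
  Adj-sym {x} {y} = trans (adj-sym G y x)

  Adj⇒≢ : ∀ {x y} → Adj G x y → x ≢ y
  Adj⇒≢ {x} a refl with () ← trans (sym (adj-irrefl G x)) a

  Adjᶜ⇒¬Adj×≢ : ∀ {x y} → Adj (complement G) x y → ¬ Adj G x y × x ≢ y
  Adjᶜ⇒¬Adj×≢ {x} {y} with adj G x y | x ≟ y
  ... | true  | _      = λ ()
  ... | false | yes _   = λ ()
  ... | false | no x≢y = λ _ → (λ ()) , x≢y

  ¬Adj×≢⇒Adjᶜ : ∀ {x y} → ¬ Adj G x y → x ≢ y → Adj (complement G) x y
  ¬Adj×≢⇒Adjᶜ {x} {y} with adj G x y | x ≟ y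
  ... | true  | _       = λ ¬a _ → contradiction refl ¬a
  ... | false | yes x≡y = λ _ x≢y → contradiction x≡y x≢y
  ... | false | no _    = λ _ _ → refl

  Walk-zero⇒≡ : ∀ {x y} → Walk G x y 0 → x ≡ y
  Walk-zero⇒≡ here = refl

  Walk-one⇒Adj : ∀ {x y} → Walk G x y 1 → Adj G x y
  Walk-one⇒Adj (step a here) = a

  Walk-snoc : ∀ {x y z k} → Walk G x y k → Adj G y z → Walk G x z (suc k)
  Walk-snoc here        a = step a here
  Walk-snoc (step b w) a = step b (Walk-snoc w a)

  Walk-reverse : ∀ {x y k} → Walk G x y k → Walk G y x k
  Walk-reverse here       = here
  Walk-reverse (step a w) = Walk-snoc (Walk-reverse w) (Adj-sym a)

  Walk? : ∀ k x y → Dec (Walk G x y k)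
  Walk? zero x y with x ≟ y
  ... | yes refl = yes here
  ... | no x≢y   = no λ w → x≢y (Walk-zero⇒≡ w)
  Walk? (suc k) x y with any? (λ z → Adj? x z ×-dec Walk? k z y)
  ... | yes (z , a , w) = yes (step a w)
  ... | no ¬step        = no λ { (step a w) → ¬step (_ , a , w) }

  IsDist-refl : ∀ x → IsDist G x x 0
  IsDist-refl x = here , λ _ ()

  IsDist-sym : ∀ {x y d} → IsDist G x y d → IsDist G y x d
  IsDist-sym (w , shortest) = Walk-reverse w , λ k k<d w′ → shortest k k<d (Walk-reverse w′)

  IsDist-zero⇒≡ : ∀ {x y} → IsDist G x y 0 → x ≡ y
  IsDist-zero⇒≡ (w , _) = Walk-zero⇒≡ w

  Adj⇒IsDist-one : ∀ {x y} → Adj G x y → IsDist G x y 1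
  Adj⇒IsDist-one a = step a here , λ { zero _ w → Adj⇒≢ a (Walk-zero⇒≡ w) ; (suc _) (s≤s ()) _ }

  commonNeighbour⇒IsDist-two : ∀ {x y z} → x ≢ y → ¬ Adj G x y →
                               Adj G x z → Adj G z y → IsDist G x y 2
  commonNeighbour⇒IsDist-two x≢y ¬a a b = step a (step b here) , λ
    { zero       _ w → x≢y (Walk-zero⇒≡ w)
    ; (suc zero) _ w → ¬a (Walk-one⇒Adj w)
    ; (suc (suc _)) (s≤s (s≤s ())) _
    }

  ¬Adj⇒2≤IsDist : ∀ {x y d} → x ≢ y → ¬ Adj G x y → IsDist G x y d → 2 ≤ d
  ¬Adj⇒2≤IsDist {d = zero}        x≢y _  (w , _) = contradiction (Walk-zero⇒≡ w) x≢y
  ¬Adj⇒2≤IsDist {d = suc zero}    _   ¬a (w , _) = contradiction (Walk-one⇒Adj w) ¬a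
  ¬Adj⇒2≤IsDist {d = suc (suc _)} _   _  _       = s≤s (s≤s z≤n)

  Connected⇒IsDist : Connected G → ∀ x y → ∃[ d ] IsDist G x y d
  Connected⇒IsDist connected x y = least-witness (λ k → Walk? k x y) (proj₂ (connected x y))

  StronglyResolves-sym : ∀ {w u v} → StronglyResolves G w u v → StronglyResolves G w v u
  StronglyResolves-sym (duw , duv , dvw , Duw , Duv , Dvw , sum) =
    dvw , duv , duw , Dvw , IsDist-sym Duv , Duw , [ inj₂ , inj₁ ] sum

  IsDist⇒source-resolves : ∀ {u v d} → IsDist G u v d → StronglyResolves G u u v
  IsDist⇒source-resolves {u} {d = d} Duv =
    0 , d , d , IsDist-refl u , Duv , IsDist-sym Duv , inj₂ (sym (+-identityʳ d))

  ClosedNbhd? : ∀ x z → Dec (ClosedNbhd G x z)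
  ClosedNbhd? x z = (z ≟ x) ⊎-dec Adj? x z

  ¬⊆⇒distinguishing-vertex : ∀ {x y} → ¬ (∀ z → ClosedNbhd G x z → ClosedNbhd G y z) →
                             ∃[ z ] (ClosedNbhd G x z × ¬ ClosedNbhd G y z)
  ¬⊆⇒distinguishing-vertex {x} {y} ¬x⊆y
    with z , ¬z ← ¬∀⟶∃¬ n _ (λ z → ClosedNbhd? x z →-dec ClosedNbhd? y z) ¬x⊆y
    = z , ¬[A→B]⇒A×¬B (ClosedNbhd? x z) ¬z

  ¬TrueTwins⇒distinguishing-vertex :
    ∀ {u v} → ¬ TrueTwins G u v →
    ∃[ z ] (ClosedNbhd G u z × ¬ ClosedNbhd G v z) ⊎ ∃[ z ] (ClosedNbhd G v z × ¬ ClosedNbhd G u z)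
  ¬TrueTwins⇒distinguishing-vertex {u} {v} ¬twins
    with all? (λ z → ClosedNbhd? u z →-dec ClosedNbhd? v z)
       | all? (λ z → ClosedNbhd? v z →-dec ClosedNbhd? u z)
  ... | yes u⊆v | yes v⊆u = contradiction (λ z → mk⇔ (u⊆v z) (v⊆u z)) ¬twins
  ... | no ¬u⊆v | _       = inj₁ (¬⊆⇒distinguishing-vertex ¬u⊆v)
  ... | yes _   | no ¬v⊆u = inj₂ (¬⊆⇒distinguishing-vertex ¬v⊆u)

  endpoint∈⇒resolved : ∀ {S u v d} → IsDist G u v d → u ∈ S ⊎ v ∈ S →
                       ∃[ w ] (w ∈ S × StronglyResolves G w u v)
  endpoint∈⇒resolved {u = u} Duv (inj₁ u∈S) = u , u∈S , IsDist⇒source-resolves Duv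
  endpoint∈⇒resolved {v = v} Duv (inj₂ v∈S) =
    v , v∈S , StronglyResolves-sym (IsDist⇒source-resolves (IsDist-sym Duv))

  edge-with-distinguishing-vertex⇒resolved :
    ∀ {S u v z} → IsVertexCover (complement G) S → Adj G u v →
    ClosedNbhd G u z → ¬ ClosedNbhd G v z → ∃[ w ] (w ∈ S × StronglyResolves G w u v)
  edge-with-distinguishing-vertex⇒resolved _ a (inj₁ refl) z∉N[v] = contradiction (inj₂ (Adj-sym a)) z∉N[v]
  edge-with-distinguishing-vertex⇒resolved {S} {u} {v} {z} cover a (inj₂ auz) z∉N[v] =
    [ (λ v∈S → endpoint∈⇒resolved (Adj⇒IsDist-one a) (inj₂ v∈S))
    , (λ z∈S → z , z∈S , 1 , 1 , 2 , Adj⇒IsDist-one auz , Adj⇒IsDist-one a ,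
               commonNeighbour⇒IsDist-two v≢z ¬avz (Adj-sym a) auz , inj₂ refl)
    ] (cover v z (¬Adj×≢⇒Adjᶜ ¬avz v≢z))
    where
    ¬avz : ¬ Adj G v z
    ¬avz = z∉N[v] ∘ inj₂
    v≢z : v ≢ z
    v≢z = z∉N[v] ∘ inj₁ ∘ sym

  cover-complement⇒generator :
    Connected G → NoTrueTwins G → ∀ S → IsVertexCover (complement G) S → IsStrongMetricGenerator G S
  cover-complement⇒generator connected noTwins S cover u v u≢v with Adj? u v
  ... | no ¬a with _ , Duv ← Connected⇒IsDist connected u v =
    endpoint∈⇒resolved Duv (cover u v (¬Adj×≢⇒Adjᶜ ¬a u≢v))
  ... | yes a with ¬TrueTwins⇒distinguishing-vertex (noTwins u v u≢v)
  ...   | inj₁ (z , z∈N[u] , z∉N[v]) = edge-with-distinguishing-vertex⇒resolved cover a z∈N[u] z∉N[v]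
  ...   | inj₂ (z , z∈N[v] , z∉N[u])
    with w , w∈S , resolves ← edge-with-distinguishing-vertex⇒resolved cover (Adj-sym a) z∈N[v] z∉N[u]
    = w , w∈S , StronglyResolves-sym resolves

  diameter-two⇒generator-covers-complement :
    IsDiameter G 2 → ∀ S → IsStrongMetricGenerator G S → IsVertexCover (complement G) S
  diameter-two⇒generator-covers-complement (bounded , _) S generates u v edgeᶜ
    with ¬a , u≢v ← Adjᶜ⇒¬Adj×≢ edgeᶜ
    with w , w∈S , duw , duv , dvw , Duw , Duv , Dvw , sum ← generates u v u≢v
    with 2≤duv ← ¬Adj⇒2≤IsDist u≢v ¬a Duv
    with sum
  ... | inj₁ duw≡duv+dvw =
    inj₂ (subst (_∈ S) (sym (IsDist-zero⇒≡ (subst (IsDist G v w) dvw≡0 Dvw))) w∈S)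
    where
    dvw≡0 : dvw ≡ 0
    dvw≡0 = m+n≤2≤m⇒n≡0 2≤duv (subst (_≤ 2) duw≡duv+dvw (bounded u w duw Duw))
  ... | inj₂ dvw≡duv+duw =
    inj₁ (subst (_∈ S) (sym (IsDist-zero⇒≡ (subst (IsDist G u w) duw≡0 Duw))) w∈S)
    where
    duw≡0 : duw ≡ 0
    duw≡0 = m+n≤2≤m⇒n≡0 2≤duv (subst (_≤ 2) dvw≡duv+duw (bounded v w dvw Dvw))

  generator⇔cover-complement :
    Connected G → IsDiameter G 2 → NoTrueTwins G →
    ∀ S → IsStrongMetricGenerator G S ⇔ IsVertexCover (complement G) S
  generator⇔cover-complement connected diameter-two noTwins S =
    mk⇔ (diameter-two⇒generator-covers-complement diameter-two S)
        (cover-complement⇒generator connected noTwins S)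

module _ {n} (G₁ G₂ H : Graph n)
         (generator⇔cover : ∀ S → IsStrongMetricGenerator G₁ S ⇔ IsVertexCover H S) where

  open Equivalence

  dim≡β : ∀ {d b} → IsStrongMetricDim G₁ d → IsVertexCoverNumber H b → d ≡ b
  dim≡β ((S , genS , ∣S∣≡d) , dimMin) ((C , coverC , ∣C∣≡b) , βMin) =
    ≤-antisym (subst (_ ≤_) ∣C∣≡b (dimMin C (from (generator⇔cover C) coverC)))
              (subst (_ ≤_) ∣S∣≡d (βMin S (to (generator⇔cover S) genS)))

  simDim≡dim⇔minimumCover-generates : ∀ {sd d b} →
    IsSimStrongMetricDim G₁ G₂ sd → IsStrongMetricDim G₁ d → IsVertexCoverNumber H b →
    (sd ≡ d) ⇔ (∃[ C ] (IsVertexCover H C × ∣ C ∣ ≡ b × IsStrongMetricGenerator G₂ C))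
  simDim≡dim⇔minimumCover-generates {sd} {d} {b}
    ((S , gen₁S , gen₂S , ∣S∣≡sd) , simMin) dim β = mk⇔ minimal⇒cover cover⇒minimal
    where
    d≡b : d ≡ b
    d≡b = dim≡β dim β
    minimal⇒cover : sd ≡ d → ∃[ C ] (IsVertexCover H C × ∣ C ∣ ≡ b × IsStrongMetricGenerator G₂ C)
    minimal⇒cover sd≡d = S , to (generator⇔cover S) gen₁S , trans ∣S∣≡sd (trans sd≡d d≡b) , gen₂S
    cover⇒minimal : ∃[ C ] (IsVertexCover H C × ∣ C ∣ ≡ b × IsStrongMetricGenerator G₂ C) → sd ≡ d
    cover⇒minimal (C , coverC , ∣C∣≡b , gen₂C) =
      ≤-antisym (subst (sd ≤_) (trans ∣C∣≡b (sym d≡b)) (simMin C (from (generator⇔cover C) coverC) gen₂C))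
                (subst (d ≤_) ∣S∣≡sd (proj₂ dim S gen₁S))

  simDim≡dim≡dim₂⇔minimumCover-generates-minimally : ∀ {sd d d₂ b} →
    IsSimStrongMetricDim G₁ G₂ sd → IsStrongMetricDim G₁ d → IsVertexCoverNumber H b →
    ((sd ≡ d) × (d ≡ d₂)) ⇔
    (∃[ C ] (IsVertexCover H C × ∣ C ∣ ≡ b × IsStrongMetricGenerator G₂ C × ∣ C ∣ ≡ d₂))
  simDim≡dim≡dim₂⇔minimumCover-generates-minimally {sd} {d} {d₂} {b} sim dim β = mk⇔
    (λ (sd≡d , d≡d₂) → let (C , coverC , ∣C∣≡b , gen₂C) = to sd≡d⇔ sd≡d
                       in C , coverC , ∣C∣≡b , gen₂C , trans ∣C∣≡b (trans (sym d≡b) d≡d₂))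
    (λ (C , coverC , ∣C∣≡b , gen₂C , ∣C∣≡d₂) →
       from sd≡d⇔ (C , coverC , ∣C∣≡b , gen₂C) , trans d≡b (trans (sym ∣C∣≡b) ∣C∣≡d₂))
    where
    sd≡d⇔ : (sd ≡ d) ⇔ (∃[ C ] (IsVertexCover H C × ∣ C ∣ ≡ b × IsStrongMetricGenerator G₂ C))
    sd≡d⇔ = simDim≡dim⇔minimumCover-generates sim dim β
    d≡b : d ≡ b
    d≡b = dim≡β dim β

mainTheorem18 : ∀ {n} (G : Graph n) →
    Connected G → IsDiameter G 2 → NoTrueTwins G → Connected (complement G) →
    ∀ (sd dG dGc b : ℕ) →
    IsSimStrongMetricDim G (complement G) sd →
    IsStrongMetricDim G dG →
    IsStrongMetricDim (complement G) dGc →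
    IsVertexCoverNumber (complement G) b →
    ((sd ≡ dG) ⇔ (∃[ C ] (IsVertexCover (complement G) C × ∣ C ∣ ≡ b × IsStrongMetricGenerator (complement G) C)))
    × (((sd ≡ dG) × (dG ≡ dGc)) ⇔ (∃[ C ] (IsVertexCover (complement G) C × ∣ C ∣ ≡ b × IsStrongMetricGenerator (complement G) C × ∣ C ∣ ≡ dGc)))
mainTheorem18 {n} G connected diameter-two noTwins _ sd dG dGc b sim dim _ β =
  simDim≡dim⇔minimumCover-generates G Gᶜ Gᶜ generator⇔cover sim dim β ,
  simDim≡dim≡dim₂⇔minimumCover-generates-minimally G Gᶜ Gᶜ generator⇔cover sim dim β
  where
  Gᶜ : Graph n
  Gᶜ = complement G
  generator⇔cover : ∀ S → IsStrongMetricGenerator G S ⇔ IsVertexCover Gᶜ S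
  generator⇔cover = generator⇔cover-complement G connected diameter-two noTwins
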